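{- Let $A$ be a finite abelian group of even order and $T$ a square-free subset of $A$ with $|T|=|A|/2-1$. If $|T-T^0|<|A|$, where $T^0=T\cup\{0\}$, then $\mathrm{CayS}(A,T)$ admits a perfect code.
   Context: Groups are written additively. An element $x\in A$ is a square if $x=2y$ for some $y\in A$; a subset is square-free if it contains no squares. For a square-free $T\subseteq A$, $\mathrm{CayS}(A,T)$ is the simple graph with vertex set $A$ where distinct $x,y$ are adjacent iff $x+y\in T$ (it is $|T|$-regular). A subset $C$ of vertices of a graph is a perfect code if every vertex is at distance at most one from exactly one vertex of $C$. For subsets $B,C\subseteq A$, $B-C=\{b-c:b\in B,c\in C\}$. -}

module Defs where

open import Data.Nat using (ℕ)
open import Data.Fin using (Fin)
open import Data.Fin.Properties using (any?) renaming (_≟_ to _≟ᶠ_)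
open import Data.Fin.Subset using (Subset; _∈_; _∉_; _∪_; ⁅_⁆)
open import Data.Fin.Subset.Properties using (_∈?_)
open import Data.Vec using (tabulate)
open import Data.Product using (∃; ∃-syntax; _×_; _,_)
open import Data.Sum using (_⊎_)
open import Relation.Nullary using (¬_; does)
open import Relation.Nullary.Decidable using (_×-dec_)
open import Relation.Binary.PropositionalEquality using (_≡_; _≢_)

-- A finite abelian group of order n is presented (up to isomorphism) with
-- carrier Fin n and operations _+_, 0#, -_ (laws supplied in the statement
-- as IsAbelianGroup _≡_ _+_ 0# -_).
module GroupNotions {n : ℕ} (_+_ : Fin n → Fin n → Fin n) (0# : Fin n) (-_ : Fin n → Fin n) where

  IsSquare : Fin n → Set
  IsSquare x = ∃[ y ] x ≡ y + y

  SquareFree : Subset n → Set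
  SquareFree T = ∀ x → x ∈ T → ¬ IsSquare x

  _⊖_ : Subset n → Subset n → Subset n
  B ⊖ C = tabulate λ x →
    does (any? λ b → any? λ c → (b ∈? B) ×-dec ((c ∈? C) ×-dec (x ≟ᶠ (b + (- c)))))

  _⁰ : Subset n → Subset n
  T ⁰ = T ∪ ⁅ 0# ⁆

  Adj : Subset n → Fin n → Fin n → Set
  Adj T x y = x ≢ y × (x + y) ∈ T

  Dist≤1 : Subset n → Fin n → Fin n → Set
  Dist≤1 T c v = c ≡ v ⊎ Adj T c v

  IsPerfectCode : Subset n → Subset n → Set
  IsPerfectCode T C = ∀ v → ∃[ c ] ((c ∈ C × Dist≤1 T c v)
                                   × (∀ c′ → c′ ∈ C → Dist≤1 T c′ v → c′ ≡ c))

module Submission where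

-- Write D = T − T⁰ and let N[c] = {c} ∪ {v ≠ c : c + v ∈ T} be the
-- closed neighbourhood of c in CayS(A,T).  Square-freeness makes c ∉ {v : c + v ∈ T},
-- and v ↦ c + v is a bijection, so |N[c]| = |T| + 1 = |A|/2.  Since |D| < |A|
-- some x lies outside D.  If x ≠ 0, then N[0] and N[x] are disjoint (a common
-- point would write x as b − c with b ∈ T, c ∈ T⁰); two disjoint sets of size
-- |A|/2 cover A, so {0, x} is a perfect code.  If x = 0 ∉ D then T is empty
-- (b − b = 0), |A| = 2 and every nonzero x works.

open import Defs
open import Data.Nat using (ℕ; _<_; _∸_; _/_)
open import Data.Nat.Divisibility using (_∣_)
open import Data.Fin using (Fin)
open import Data.Fin.Subset using (Subset; ∣_∣)
open import Data.Product using (∃-syntax)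
open import Algebra.Structures using (IsAbelianGroup)
open import Relation.Binary.PropositionalEquality using (_≡_)

open import Data.Nat as ℕ using (zero; suc; _≤_; z≤n; s≤s)
import Data.Nat.Properties as ℕP
open import Data.Nat.DivMod using (m*n/n≡m)
open import Data.Nat.Divisibility using (divides)
import Data.Fin as F
open import Data.Fin.Properties using (¬∀⟶∃¬; any?) renaming (_≟_ to _≟ᶠ_)
open import Data.Fin.Subset using (_∈_; _∉_; _∪_; ⁅_⁆; ⊤)
open import Data.Fin.Subset.Properties
  using (_∈?_; x∈p∪q⁺; x∈p∪q⁻; x∈⁅x⁆; x∈⁅y⁆⇒x≡y; p⊆q⇒∣p∣≤∣q∣; ∣⊤∣≡n; ∣⁅x⁆∣≡1)
open import Data.Vec using ([]; _∷_; lookup)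
open import Data.Vec.Properties using ([]=⇒lookup; lookup⇒[]=; lookup∘tabulate)
open import Data.Bool using (Bool; true; false)
open import Data.Product using (∃; _×_; _,_; proj₁; proj₂)
open import Data.Sum using (_⊎_; inj₁; inj₂)
open import Data.Empty using (⊥; ⊥-elim)
open import Function using (_∘_)
open import Relation.Nullary using (Dec; yes; no)
open import Relation.Nullary.Decidable using (_×-dec_; dec-true)
open import Relation.Binary.PropositionalEquality
  using (refl; sym; trans; cong; cong₂; subst; _≢_; module ≡-Reasoning)
open import Data.Fin.Permutation using (Permutation; permutation)
import Algebra.Properties.CommutativeMonoid.Sum as SumProps

open SumProps ℕP.+-0-commutativeMonoid using (sum; sum-permute; ∑-distrib-+)

-- Booleans as 0/1; subsets of Fin n are counted as sums of these.
ind : Bool → ℕ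
ind true  = 1
ind false = 0

χ : ∀ {n} → Subset n → Fin n → ℕ
χ p v = ind (lookup p v)

∣p∣≡∑χ : ∀ {n} (p : Subset n) → ∣ p ∣ ≡ sum (χ p)
∣p∣≡∑χ []          = refl
∣p∣≡∑χ (true ∷ p)  = cong suc (∣p∣≡∑χ p)
∣p∣≡∑χ (false ∷ p) = ∣p∣≡∑χ p

∑≤n : ∀ {n} (f : Fin n → ℕ) → (∀ v → f v ≤ 1) → sum f ≤ n
∑≤n {zero}  f f≤1 = z≤n
∑≤n {suc n} f f≤1 = ℕP.+-mono-≤ (f≤1 F.zero) (∑≤n (λ v → f (F.suc v)) (λ v → f≤1 (F.suc v)))

split-1+n : ∀ {a b n} → a ≤ 1 → b ≤ n → a ℕ.+ b ≡ suc n → a ≡ 1 × b ≡ n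
split-1+n z≤n       b≤n refl = ⊥-elim (ℕP.1+n≰n b≤n)
split-1+n (s≤s z≤n) _   eq   = refl , ℕP.suc-injective eq

∑≡n⇒all≡1 : ∀ {n} (f : Fin n → ℕ) → (∀ v → f v ≤ 1) → sum f ≡ n → ∀ v → f v ≡ 1
∑≡n⇒all≡1 f f≤1 ∑≡ F.zero    = proj₁ (split-1+n (f≤1 F.zero) (∑≤n (f ∘ F.suc) (f≤1 ∘ F.suc)) ∑≡)
∑≡n⇒all≡1 f f≤1 ∑≡ (F.suc v) =
  ∑≡n⇒all≡1 (f ∘ F.suc) (f≤1 ∘ F.suc)
    (proj₂ (split-1+n (f≤1 F.zero) (∑≤n (f ∘ F.suc) (f≤1 ∘ F.suc)) ∑≡)) v

missingPoint : ∀ {n} (p : Subset n) → ∣ p ∣ < n → ∃ λ x → x ∉ p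
missingPoint {n} p ∣p∣<n = ¬∀⟶∃¬ n (_∈ p) (_∈? p) λ p-full →
  ℕP.<⇒≱ ∣p∣<n (subst (_≤ ∣ p ∣) (∣⊤∣≡n n) (p⊆q⇒∣p∣≤∣q∣ {p = ⊤} (λ {x} _ → p-full x)))

anotherPoint : ∀ {n} → 2 ≤ n → (a : Fin n) → ∃ λ b → b ≢ a
anotherPoint (s≤s (s≤s _)) F.zero    = F.suc F.zero , λ ()
anotherPoint (s≤s (s≤s _)) (F.suc a) = F.zero , λ ()

halfOrder : ∀ {n t} → Fin n → 2 ∣ n → t ≡ n / 2 ∸ 1 → 2 ≤ n × suc t ℕ.+ suc t ≡ n
halfOrder ()  (divides zero    refl) _
halfOrder {t = t} _ (divides (suc q) refl) t≡ = s≤s (s≤s z≤n) , (begin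
  suc t ℕ.+ suc t            ≡⟨ cong (λ s → suc s ℕ.+ suc s) (trans t≡ (cong (_∸ 1) (m*n/n≡m (suc q) 2))) ⟩
  suc q ℕ.+ suc q            ≡⟨ cong (suc q ℕ.+_) (sym (ℕP.+-identityʳ (suc q))) ⟩
  2 ℕ.* suc q                ≡⟨ ℕP.*-comm 2 (suc q) ⟩
  suc q ℕ.* 2                ∎)
  where open ≡-Reasoning

module GroupFacts {n : ℕ} (_+_ : Fin n → Fin n → Fin n) (0# : Fin n) (-_ : Fin n → Fin n)
                  (G : IsAbelianGroup _≡_ _+_ 0# -_) where

  open GroupNotions _+_ 0# -_
  open IsAbelianGroup G using (assoc; identityˡ; identityʳ; inverseˡ; inverseʳ)
  open ≡-Reasoning

  x+v-v≡x : ∀ x v → (x + v) + (- v) ≡ x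
  x+v-v≡x x v = begin
    (x + v) + (- v)  ≡⟨ assoc x v (- v) ⟩
    x + (v + (- v))  ≡⟨ cong (x +_) (inverseʳ v) ⟩
    x + 0#           ≡⟨ identityʳ x ⟩
    x                ∎

  x-0≡x : ∀ x → x + (- 0#) ≡ x
  x-0≡x x = begin
    x + (- 0#)         ≡⟨ cong (_+ (- 0#)) (sym (identityʳ x)) ⟩
    (x + 0#) + (- 0#)  ≡⟨ x+v-v≡x x 0# ⟩
    x                  ∎

  -- Translation by c permutes the group, so it does not change sums over it.
  ∑-translate : ∀ c (f : Fin n → ℕ) → sum (λ v → f (c + v)) ≡ sum f
  ∑-translate c f = sym (sum-permute f translation)
    where
    cancel : ∀ a b → a + b ≡ 0# → ∀ w → a + (b + w) ≡ w
    cancel a b a+b≡0 w = trans (sym (assoc a b w)) (trans (cong (_+ w) a+b≡0) (identityˡ w))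
    translation : Permutation n n
    translation = permutation (c +_) ((- c) +_) (cancel c (- c) (inverseʳ c)) (cancel (- c) c (inverseˡ c))

  member⊖ : ∀ B C x → Dec (∃ λ b → ∃ λ c → b ∈ B × c ∈ C × x ≡ b + (- c))
  member⊖ B C x = any? λ b → any? λ c → (b ∈? B) ×-dec ((c ∈? C) ×-dec (x ≟ᶠ (b + (- c))))

  ∈⊖ : ∀ {B C b c} → b ∈ B → c ∈ C → (b + (- c)) ∈ B ⊖ C
  ∈⊖ {B} {C} {b} {c} b∈B c∈C = lookup⇒[]= (b + (- c)) (B ⊖ C)
    (trans (lookup∘tabulate _ (b + (- c))) (dec-true (member⊖ B C (b + (- c))) (b , c , b∈B , c∈C , refl)))

  pairCode : ∀ T c d → (∀ v → Dist≤1 T c v → Dist≤1 T d v → ⊥)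
           → (∀ v → Dist≤1 T c v ⊎ Dist≤1 T d v) → IsPerfectCode T (⁅ c ⁆ ∪ ⁅ d ⁆)
  pairCode T c d disjoint covers v with covers v
  ... | inj₁ cv = c , (x∈p∪q⁺ (inj₁ (x∈⁅x⁆ c)) , cv) , only-c
    where
    only-c : ∀ c′ → c′ ∈ ⁅ c ⁆ ∪ ⁅ d ⁆ → Dist≤1 T c′ v → c′ ≡ c
    only-c c′ c′∈ c′v with x∈p∪q⁻ ⁅ c ⁆ ⁅ d ⁆ c′∈
    ... | inj₁ c′∈c = x∈⁅y⁆⇒x≡y c c′∈c
    ... | inj₂ c′∈d = ⊥-elim (disjoint v cv (subst (λ z → Dist≤1 T z v) (x∈⁅y⁆⇒x≡y d c′∈d) c′v))
  ... | inj₂ dv = d , (x∈p∪q⁺ (inj₂ (x∈⁅x⁆ d)) , dv) , only-d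
    where
    only-d : ∀ c′ → c′ ∈ ⁅ c ⁆ ∪ ⁅ d ⁆ → Dist≤1 T c′ v → c′ ≡ d
    only-d c′ c′∈ c′v with x∈p∪q⁻ ⁅ c ⁆ ⁅ d ⁆ c′∈
    ... | inj₁ c′∈c = ⊥-elim (disjoint v (subst (λ z → Dist≤1 T z v) (x∈⁅y⁆⇒x≡y c c′∈c) c′v) dv)
    ... | inj₂ c′∈d = x∈⁅y⁆⇒x≡y d c′∈d

  module CayleySum (T : Subset n) (sf : SquareFree T) where

    -- Indicator of the closed neighbourhood of c: [v = c] + [c + v ∈ T].
    ball : Fin n → Fin n → ℕ
    ball c v = χ ⁅ c ⁆ v ℕ.+ χ T (c + v)

    -- Square-freeness makes the two summands exclusive (c + c is a square), so
    -- the indicator is 0, or it is 1 and v is within distance one of c.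
    ball-spec : ∀ c v → ball c v ≡ 0 ⊎ (ball c v ≡ 1 × Dist≤1 T c v)
    ball-spec c v with lookup ⁅ c ⁆ v in v∈?c | lookup T (c + v) in c+v∈?T
    ... | true | true = ⊥-elim (sf (c + v) (lookup⇒[]= (c + v) T c+v∈?T) (c , cong (c +_) v≡c))
      where
      v≡c : v ≡ c
      v≡c = x∈⁅y⁆⇒x≡y c (lookup⇒[]= v ⁅ c ⁆ v∈?c)
    ... | true  | false = inj₂ (refl , inj₁ (sym (x∈⁅y⁆⇒x≡y c (lookup⇒[]= v ⁅ c ⁆ v∈?c))))
    ... | false | true  = inj₂ (refl , inj₂ (c≢v , lookup⇒[]= (c + v) T c+v∈?T))
      where
      c≢v : c ≢ v
      c≢v refl with trans (sym v∈?c) ([]=⇒lookup (x∈⁅x⁆ c))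
      ... | ()
    ... | false | false = inj₁ refl

    ∑ball≡1+∣T∣ : ∀ c → sum (ball c) ≡ suc ∣ T ∣
    ∑ball≡1+∣T∣ c = begin
      sum (ball c)                                  ≡⟨ ∑-distrib-+ (χ ⁅ c ⁆) (λ v → χ T (c + v)) ⟩
      sum (χ ⁅ c ⁆) ℕ.+ sum (λ v → χ T (c + v))     ≡⟨ cong₂ ℕ._+_ (sym (∣p∣≡∑χ ⁅ c ⁆)) (∑-translate c (χ T)) ⟩
      ∣ ⁅ c ⁆ ∣ ℕ.+ sum (χ T)                       ≡⟨ cong₂ ℕ._+_ (∣⁅x⁆∣≡1 c) (sym (∣p∣≡∑χ T)) ⟩
      suc ∣ T ∣                                     ∎

    Separated : Fin n → Set
    Separated x = x ≢ 0# × (∀ {b c} → b ∈ T → c ∈ T ⁰ → x ≢ b + (- c))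

    0+v∈T⇒v∈T : ∀ {v} → (0# + v) ∈ T → v ∈ T
    0+v∈T⇒v∈T {v} = subst (_∈ T) (identityˡ v)

    disjoint : ∀ {x} → Separated x → ∀ v → Dist≤1 T 0# v → Dist≤1 T x v → ⊥
    disjoint (x≢0 , _)     v (inj₁ 0≡v)        (inj₁ x≡v)        = x≢0 (trans x≡v (sym 0≡v))
    disjoint {x} (_ , sep) v (inj₁ 0≡v)        (inj₂ (_ , x+v∈T)) =
      sep x+v∈T (x∈p∪q⁺ (inj₂ (subst (_∈ ⁅ 0# ⁆) 0≡v (x∈⁅x⁆ 0#)))) (sym (x+v-v≡x x v))
    disjoint {x} (_ , sep) v (inj₂ (_ , 0+v∈T)) (inj₁ x≡v)        =
      sep (0+v∈T⇒v∈T 0+v∈T) (x∈p∪q⁺ (inj₂ (x∈⁅x⁆ 0#))) (trans x≡v (sym (x-0≡x v)))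
    disjoint {x} (_ , sep) v (inj₂ (_ , 0+v∈T)) (inj₂ (_ , x+v∈T)) =
      sep x+v∈T (x∈p∪q⁺ (inj₁ (0+v∈T⇒v∈T 0+v∈T))) (sym (x+v-v≡x x v))

    pair≤1 : ∀ {x} → Separated x → ∀ v → ball 0# v ℕ.+ ball x v ≤ 1
    pair≤1 {x} sep v with ball-spec 0# v | ball-spec x v
    ... | inj₁ b0       | inj₁ bx       = subst (_≤ 1) (sym (cong₂ ℕ._+_ b0 bx)) z≤n
    ... | inj₁ b0       | inj₂ (bx , _) = subst (_≤ 1) (sym (cong₂ ℕ._+_ b0 bx)) ℕP.≤-refl
    ... | inj₂ (b0 , _) | inj₁ bx       = subst (_≤ 1) (sym (cong₂ ℕ._+_ b0 bx)) ℕP.≤-refl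
    ... | inj₂ (_ , 0v) | inj₂ (_ , xv) = ⊥-elim (disjoint sep v 0v xv)

    -- If the neighbourhoods of 0 and of a separated x have total size n,
    -- they cover every vertex: each vertex is counted exactly once.
    covers : ∀ {x} → Separated x → suc ∣ T ∣ ℕ.+ suc ∣ T ∣ ≡ n
           → ∀ v → Dist≤1 T 0# v ⊎ Dist≤1 T x v
    covers {x} sep total v
      with ball-spec 0# v | ball-spec x v | ∑≡n⇒all≡1 (λ w → ball 0# w ℕ.+ ball x w) (pair≤1 sep) ∑pair≡n v
      where
      ∑pair≡n : sum (λ w → ball 0# w ℕ.+ ball x w) ≡ n
      ∑pair≡n = trans (∑-distrib-+ (ball 0#) (ball x))
                  (trans (cong₂ ℕ._+_ (∑ball≡1+∣T∣ 0#) (∑ball≡1+∣T∣ x)) total)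
    ... | inj₂ (_ , 0v) | _             | _         = inj₁ 0v
    ... | inj₁ _        | inj₂ (_ , xv) | _         = inj₂ xv
    ... | inj₁ b0       | inj₁ bx       | counted-1 = ⊥-elim (ℕP.0≢1+n (trans (sym (cong₂ ℕ._+_ b0 bx)) counted-1))

    separatedPoint : 2 ≤ n → ∣ T ⊖ (T ⁰) ∣ < n → ∃ Separated
    separatedPoint 2≤n small with missingPoint (T ⊖ (T ⁰)) small
    ... | x , x∉D with x ≟ᶠ 0#
    ...   | no x≢0 = x , x≢0 , λ b∈T c∈T⁰ x≡b-c → x∉D (subst (_∈ T ⊖ (T ⁰)) (sym x≡b-c) (∈⊖ b∈T c∈T⁰))
    ...   | yes x≡0 with anotherPoint 2≤n 0#
    ...     | y , y≢0 = y , y≢0 , λ b∈T _ _ → T-empty b∈T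
      where
      -- 0 = b − b for b ∈ T, so 0 ∉ T − T⁰ forces T = ∅ and separation is vacuous.
      T-empty : ∀ {b} → b ∉ T
      T-empty {b} b∈T =
        x∉D (subst (_∈ T ⊖ (T ⁰)) (trans (inverseʳ b) (sym x≡0)) (∈⊖ b∈T (x∈p∪q⁺ (inj₁ b∈T))))

corollary2p8 : (n : ℕ) (_+_ : Fin n → Fin n → Fin n) (0# : Fin n) (-_ : Fin n → Fin n)
    → IsAbelianGroup _≡_ _+_ 0# -_
    → 2 ∣ n
    → (T : Subset n)
    → GroupNotions.SquareFree _+_ 0# -_ T
    → ∣ T ∣ ≡ n / 2 ∸ 1
    → ∣ GroupNotions._⊖_ _+_ 0# -_ T (GroupNotions._⁰ _+_ 0# -_ T) ∣ < n
    → ∃[ C ] GroupNotions.IsPerfectCode _+_ 0# -_ T C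
corollary2p8 n _+_ 0# -_ G 2∣n T sf ∣T∣≡ small = perfectCode (halfOrder 0# 2∣n ∣T∣≡)
  where
  open GroupNotions _+_ 0# -_
  open GroupFacts _+_ 0# -_ G
  open CayleySum T sf

  perfectCode : 2 ≤ n × suc ∣ T ∣ ℕ.+ suc ∣ T ∣ ≡ n → ∃[ C ] IsPerfectCode T C
  perfectCode (2≤n , total) with separatedPoint 2≤n small
  ... | x , sep = ⁅ 0# ⁆ ∪ ⁅ x ⁆ , pairCode T 0# x (disjoint sep) (covers sep total)
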